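{- Let $v_1=(x_1,y_1,z_1)$ and $v_2=(x_2,y_2,z_2)$ be distinct points of $\mathbb{Z}^3$, let $d\ge d(v_1,v_2)$ be an integer, $\delta=d-d(v_1,v_2)$, and let ${\cal A}_d(v_1,v_2)$ be the optimal tristance anticode in ${\cal G}_3$ of diameter $d$ centered about $v_1$ and $v_2$. Let $x_{\max}=\max\{x_1,x_2\}$, $x_{\min}=\min\{x_1,x_2\}$, and define $y_{\max},y_{\min},z_{\max},z_{\min}$ similarly. Then ${\cal A}_d(v_1,v_2)$ consists of all $(x,y,z)\in\mathbb{Z}^3$ such that $x_{\min}-\delta\le x\le x_{\max}+\delta$; $y_{\min}-\delta\le y\le y_{\max}+\delta$; $z_{\min}-\delta\le z\le z_{\max}+\delta$; $x_{\min}+y_{\min}-\delta\le x+y\le x_{\max}+y_{\max}+\delta$; $x_{\min}-y_{\max}-\delta\le x-y\le x_{\max}-y_{\min}+\delta$; $x_{\min}+z_{\min}-\delta\le x+z\le x_{\max}+z_{\max}+\delta$; $x_{\min}-z_{\max}-\delta\le x-z\le x_{\max}-z_{\min}+\delta$; $y_{\min}+z_{\min}-\delta\le y+z\le y_{\max}+z_{\max}+\delta$; $y_{\min}-z_{\max}-\delta\le y-z\le y_{\max}-z_{\min}+\delta$; $x_{\min}+y_{\min}+z_{\min}-\delta\le x+y+z\le x_{\max}+y_{\max}+z_{\max}+\delta$; $x_{\min}-y_{\max}+z_{\min}-\delta\le x-y+z\le x_{\max}-y_{\min}+z_{\max}+\delta$; $x_{\min}+y_{\min}-z_{\max}-\delta\le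 x+y-z\le x_{\max}+y_{\max}-z_{\min}+\delta$; $x_{\min}-y_{\max}-z_{\max}-\delta\le x-y-z\le x_{\max}-y_{\min}-z_{\min}+\delta$.
   Context: The grid graph ${\cal G}_3$ has vertex set $\mathbb{Z}^3$, two points being adjacent iff their $L_1$-distance $d(\cdot,\cdot)$ is $1$. For $v,v',v''\in\mathbb{Z}^3$, the tristance $d_3(v,v',v'')$ is the minimum number of edges of a tree in ${\cal G}_3$ (possibly using additional vertices) containing them. A set ${\cal A}\subset\mathbb{Z}^3$ is a tristance anticode of diameter $d$ centered about $v_1,v_2$ if $d_3(v_1,v_2,v)\le d$ for all $v\in{\cal A}$; it is optimal if it has largest possible cardinality among such sets. -}

module Defs where

open import Data.Nat as ℕ using (ℕ; zero; suc; _∸_)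
open import Data.Integer using (ℤ; +_; _+_; _-_; _≤_; ∣_∣; _⊓_; _⊔_)
open import Data.Product using (_×_; _,_; Σ; ∃)
open import Data.List using (List; []; _∷_; length)
open import Data.List.Membership.Propositional using (_∈_; _∉_)
open import Data.List.Relation.Unary.Unique.Propositional using (Unique)
open import Data.List.Relation.Unary.All using (All)
open import Relation.Binary.PropositionalEquality using (_≡_)

Point : Set
Point = ℤ × ℤ × ℤ

dist : Point → Point → ℕ
dist (x , y , z) (x' , y' , z') = ∣ x - x' ∣ ℕ.+ ∣ y - y' ∣ ℕ.+ ∣ z - z' ∣

Adjacent : Point → Point → Set
Adjacent p q = dist p q ≡ 1

-- Finite trees in G₃: TreeOn n vs means vs is the vertex list of a tree
-- (subgraph of G₃) with exactly n edges, built by repeatedly attaching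
-- a new leaf w to an existing vertex u via a grid edge.
data TreeOn : ℕ → List Point → Set where
  single : (p : Point) → TreeOn 0 (p ∷ [])
  grow   : ∀ {n vs} (u w : Point) → TreeOn n vs → u ∈ vs → w ∉ vs →
           Adjacent u w → TreeOn (suc n) (w ∷ vs)

-- d₃(a,b,c) ≤ d : there is a tree in G₃ with at most d edges containing a, b, c
-- (equivalently, the minimum number of edges of such a tree is ≤ d).
Tristance≤ : Point → Point → Point → ℕ → Set
Tristance≤ a b c d =
  Σ ℕ λ n → Σ (List Point) λ vs →
    TreeOn n vs × n ℕ.≤ d × a ∈ vs × b ∈ vs × c ∈ vs

-- finite subsets of ℤ³ as duplicate-free lists; cardinality = length
IsAnticode : ℕ → Point → Point → List Point → Set
IsAnticode d v₁ v₂ A = Unique A × All (λ v → Tristance≤ v₁ v₂ v d) A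

IsOptimalAnticode : ℕ → Point → Point → List Point → Set
IsOptimalAnticode d v₁ v₂ A =
  IsAnticode d v₁ v₂ A ×
  ((B : List Point) → IsAnticode d v₁ v₂ B → length B ℕ.≤ length A)

Between : ℤ → ℤ → ℤ → Set
Between a t b = (a ≤ t) × (t ≤ b)

InRegion : ℕ → Point → Point → Point → Set
InRegion d v₁@(x₁ , y₁ , z₁) v₂@(x₂ , y₂ , z₂) (x , y , z) =
  let δ = + (d ∸ dist v₁ v₂)
      xM = x₁ ⊔ x₂ ; xm = x₁ ⊓ x₂
      yM = y₁ ⊔ y₂ ; ym = y₁ ⊓ y₂
      zM = z₁ ⊔ z₂ ; zm = z₁ ⊓ z₂
  in Between (xm - δ) x (xM + δ)
   × Between (ym - δ) y (yM + δ)
   × Between (zm - δ) z (zM + δ)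
   × Between (xm + ym - δ) (x + y) (xM + yM + δ)
   × Between (xm - yM - δ) (x - y) (xM - ym + δ)
   × Between (xm + zm - δ) (x + z) (xM + zM + δ)
   × Between (xm - zM - δ) (x - z) (xM - zm + δ)
   × Between (ym + zm - δ) (y + z) (yM + zM + δ)
   × Between (ym - zM - δ) (y - z) (yM - zm + δ)
   × Between (xm + ym + zm - δ) (x + y + z) (xM + yM + zM + δ)
   × Between (xm - yM + zm - δ) (x - y + z) (xM - ym + zM + δ)
   × Between (xm + ym - zM - δ) (x + y - z) (xM + yM - zm + δ)
   × Between (xm - yM - zM - δ) (x - y - z) (xM - ym - zm + δ)

-- Along each axis, a tree containing v₁, v₂, v must cover the spread (maximum minus
-- minimum) of their three coordinates, since its edges project onto a connected set;
-- conversely the three axis-parallel paths from the coordinatewise median attain this.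
-- So d₃(v₁, v₂, v) is the sum of the three spreads. The spread of a, b, c is |a − b|
-- plus the distance from c to the interval spanned by a and b, so d₃(v₁, v₂, v) ≤ d
-- says that the three interval distances sum to at most δ. Each distance is a maximum
-- of three affine functions, and a sum of maxima is the maximum of the 27 sums: this
-- is the system of 26 inequalities defining the region (the 27th reads 0 ≤ δ). The
-- region is finite, hence can be listed; the list contains every anticode, so it is
-- optimal, and an optimal anticode missing one of its points could be enlarged.
module Submission where

open import Defs
open import Data.Empty using (⊥-elim)
open import Data.Nat as ℕ using (ℕ; zero; suc; _∸_)
import Data.Nat.Properties as ℕₚ
import Data.Nat.Tactic.RingSolver as ℕ-Ring
open import Data.Integer
  using (ℤ; +_; -[1+_]; 0ℤ; 1ℤ; -1ℤ; _+_; _-_; -_; _≤_; _≤?_; ∣_∣; _⊓_; _⊔_; +≤+; -≤+; NonNegative; nonNegative)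
open import Data.Integer.Properties
open import Data.Integer.Tactic.RingSolver using (solve; solve-∀)
open import Algebra.Bundles using (AbelianGroup)
open import Algebra.Properties.Group (AbelianGroup.group +-0-abelianGroup) using (∙-cancelˡ)
open import Data.Product using (Σ; ∃; _×_; _,_; proj₁; proj₂)
open import Data.Product.Properties using (≡-dec)
open import Data.Sum using (inj₁; inj₂)
open import Data.List using (List; []; _∷_; length; applyUpTo; filter; cartesianProduct)
open import Data.List.Properties using (length-removeAt′)
open import Data.List.Relation.Unary.Any using (here; there; index)
import Data.List.Relation.Unary.All as All
open import Data.List.Relation.Unary.AllPairs using (_∷_)
open import Data.List.Relation.Unary.Unique.Propositional using (Unique)
import Data.List.Relation.Unary.Unique.Propositional.Properties as Unique
open import Data.List.Membership.Propositional using (_∈_; _─_)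
open import Data.List.Membership.Propositional.Properties
  using (∈-applyUpTo⁺; ∈-filter⁺; ∈-filter⁻; ∈-cartesianProduct⁺)
open import Data.List.Relation.Binary.Subset.Propositional using (_⊆_)
open import Function using (_∘_; id)
open import Function.Bundles using (_⇔_; mk⇔; Equivalence)
open import Function.Properties.Equivalence using () renaming (trans to ⇔-trans)
open import Relation.Nullary using (Dec; yes; no)
open import Relation.Binary.PropositionalEquality

open Equivalence using (to; from)

_≟ₚ_ : (p q : Point) → Dec (p ≡ q)
_≟ₚ_ = ≡-dec _≟_ (≡-dec _≟_ _≟_)

open import Data.List.Membership.DecPropositional _≟ₚ_ using (_∈?_)

≤-resp-difference : ∀ {u w s t} → u ≤ w → s - t ≡ u - w → s ≤ t
≤-resp-difference u≤w eq = i-j≤0⇒i≤j (subst (_≤ 0ℤ) (sym eq) (i≤j⇒i-j≤0 u≤w))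

+-cancelˡ-≤ : ∀ i {j k} → i + j ≤ i + k → j ≤ k
+-cancelˡ-≤ i {j} {k} i+j≤i+k = ≤-resp-difference i+j≤i+k (solve (i ∷ j ∷ k ∷ []))

i≤∣i∣ : ∀ i → i ≤ + ∣ i ∣
i≤∣i∣ (+ n)    = ≤-refl
i≤∣i∣ -[1+ n ] = -≤+

∣-∣-≥ : ∀ {i j} → j ≤ i → + ∣ i - j ∣ ≡ i - j
∣-∣-≥ {i} {j} j≤i = trans (cong +_ (∣i-j∣≡∣j-i∣ i j)) (∣-∣-≤ j≤i)

∣i-i∣≡0 : ∀ i → ∣ i - i ∣ ≡ 0
∣i-i∣≡0 i = cong ∣_∣ (+-inverseʳ i)

∣i-k∣≤∣i-j∣+∣j-k∣ : ∀ i j k → ∣ i - k ∣ ℕ.≤ ∣ i - j ∣ ℕ.+ ∣ j - k ∣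
∣i-k∣≤∣i-j∣+∣j-k∣ i j k =
  ℕₚ.≤-trans (ℕₚ.≤-reflexive (cong ∣_∣ split)) (∣i+j∣≤∣i∣+∣j∣ (i - j) (j - k))
  where
  split : i - k ≡ (i - j) + (j - k)
  split = solve (i ∷ j ∷ k ∷ [])

⊔-minus-⊓ : ∀ a b → (a ⊔ b) - (a ⊓ b) ≡ + ∣ a - b ∣
⊔-minus-⊓ a b with ≤-total a b
... | inj₁ a≤b rewrite i≤j⇒i⊔j≡j a≤b | i≤j⇒i⊓j≡i a≤b = sym (∣-∣-≤ a≤b)
... | inj₂ b≤a rewrite i≥j⇒i⊔j≡i b≤a | i≥j⇒i⊓j≡j b≤a = sym (∣-∣-≥ b≤a)

pos-+₃ : ∀ a b c → + (a ℕ.+ b ℕ.+ c) ≡ + a + + b + + c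
pos-+₃ a b c = trans (pos-+ (a ℕ.+ b) c) (cong (_+ + c) (pos-+ a b))

+-interchange₃ : ∀ a b c p q r → (a + p) + (b + q) + (c + r) ≡ (a + b + c) + (p + q + r)
+-interchange₃ = solve-∀

ℕ-+-interchange₃ : ∀ a b c p q r →
  (a ℕ.+ p) ℕ.+ (b ℕ.+ q) ℕ.+ (c ℕ.+ r) ≡ (a ℕ.+ b ℕ.+ c) ℕ.+ (p ℕ.+ q ℕ.+ r)
ℕ-+-interchange₃ = ℕ-Ring.solve-∀

-- Distance to an interval

gap : ℤ → ℤ → ℤ → ℤ
gap lo hi c = ((c - hi) ⊔ (lo - c)) ⊔ 0ℤ

above≤gap : ∀ lo hi c → c - hi ≤ gap lo hi c
above≤gap lo hi c = ≤-trans (i≤i⊔j _ _) (i≤i⊔j _ _)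

below≤gap : ∀ lo hi c → lo - c ≤ gap lo hi c
below≤gap lo hi c = ≤-trans (i≤j⊔i _ _) (i≤i⊔j _ _)

0≤gap : ∀ lo hi c → 0ℤ ≤ gap lo hi c
0≤gap lo hi c = i≤j⊔i _ _

gap-lub : ∀ {lo hi c t} → c - hi ≤ t → lo - c ≤ t → 0ℤ ≤ t → gap lo hi c ≤ t
gap-lub c-hi≤t lo-c≤t 0≤t = ⊔-lub (⊔-lub c-hi≤t lo-c≤t) 0≤t

data GapView (lo hi c : ℤ) : Set where
  below  : gap lo hi c ≡ lo - c → GapView lo hi c
  inside : gap lo hi c ≡ 0ℤ    → GapView lo hi c
  above  : gap lo hi c ≡ c - hi → GapView lo hi c

gapView : ∀ lo hi c → GapView lo hi c
gapView lo hi c with ⊔-sel ((c - hi) ⊔ (lo - c)) 0ℤ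
... | inj₂ g≡0 = inside g≡0
... | inj₁ g≡m with ⊔-sel (c - hi) (lo - c)
...   | inj₁ m≡above = above (trans g≡m m≡above)
...   | inj₂ m≡below = below (trans g≡m m≡below)

record Within (lo hi g c : ℤ) : Set where
  constructor within
  field
    lower : lo - g ≤ c
    upper : c ≤ hi + g

infixl 6 _⊕_
infix  8 ⊖_

_⊕_ : ∀ {lo hi g c lo′ hi′ g′ c′} →
      Within lo hi g c → Within lo′ hi′ g′ c′ → Within (lo + lo′) (hi + hi′) (g + g′) (c + c′)
_⊕_ {lo} {hi} {g} {c} {lo′} {hi′} {g′} {c′} (within l u) (within l′ u′) =
  within (≤-resp-difference (+-mono-≤ l l′) (solve vars))
         (≤-resp-difference (+-mono-≤ u u′) (solve vars))
  where vars = lo ∷ hi ∷ g ∷ c ∷ lo′ ∷ hi′ ∷ g′ ∷ c′ ∷ []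

⊖_ : ∀ {lo hi g c} → Within lo hi g c → Within (- hi) (- lo) g (- c)
⊖_ {lo} {hi} {g} {c} (within l u) =
  within (≤-resp-difference { - (hi + g)} { - c} (neg-mono-≤ u) (solve vars))
         (≤-resp-difference { - c} { - (lo - g)} (neg-mono-≤ l) (solve vars))
  where vars = lo ∷ hi ∷ g ∷ c ∷ []

widen : ∀ {lo hi g c t} → g ≤ t → Within lo hi g c → Between (lo - t) c (hi + t)
widen {lo} {hi} g≤t (within l u) =
  ≤-trans (+-monoʳ-≤ lo (neg-mono-≤ g≤t)) l , ≤-trans u (+-monoʳ-≤ hi g≤t)

deviations≤⇒within : ∀ {lo hi g c} → lo - c ≤ g → c - hi ≤ g → Within lo hi g c
deviations≤⇒within {lo} {hi} {g} {c} lo-c≤g c-hi≤g =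
  within (≤-resp-difference lo-c≤g (solve vars)) (≤-resp-difference c-hi≤g (solve vars))
  where vars = lo ∷ hi ∷ g ∷ c ∷ []

gap-within : ∀ lo hi c → Within lo hi (gap lo hi c) c
gap-within lo hi c = deviations≤⇒within (below≤gap lo hi c) (above≤gap lo hi c)

-- InRegion d v₁ v₂ is Region (+ (d ∸ dist v₁ v₂)) at the coordinate ranges of v₁, v₂.
Region : (δ xm xM ym yM zm zM : ℤ) → Point → Set
Region δ xm xM ym yM zm zM (x , y , z) =
     Between (xm - δ) x (xM + δ)
   × Between (ym - δ) y (yM + δ)
   × Between (zm - δ) z (zM + δ)
   × Between (xm + ym - δ) (x + y) (xM + yM + δ)
   × Between (xm - yM - δ) (x - y) (xM - ym + δ)
   × Between (xm + zm - δ) (x + z) (xM + zM + δ)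
   × Between (xm - zM - δ) (x - z) (xM - zm + δ)
   × Between (ym + zm - δ) (y + z) (yM + zM + δ)
   × Between (ym - zM - δ) (y - z) (yM - zm + δ)
   × Between (xm + ym + zm - δ) (x + y + z) (xM + yM + zM + δ)
   × Between (xm - yM + zm - δ) (x - y + z) (xM - ym + zM + δ)
   × Between (xm + ym - zM - δ) (x + y - z) (xM + yM - zm + δ)
   × Between (xm - yM - zM - δ) (x - y - z) (xM - ym - zm + δ)

gaps≤⇒region : ∀ δ xm xM ym yM zm zM {x y z} →
  gap xm xM x + gap ym yM y + gap zm zM z ≤ δ → Region δ xm xM ym yM zm zM (x , y , z)
gaps≤⇒region δ xm xM ym yM zm zM {x} {y} {z} gaps≤δ =
    widen gx≤δ X , widen gy≤δ Y , widen gz≤δ Z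
  , widen gx+gy≤δ (X ⊕ Y) , widen gx+gy≤δ (X ⊕ ⊖ Y)
  , widen gx+gz≤δ (X ⊕ Z) , widen gx+gz≤δ (X ⊕ ⊖ Z)
  , widen gy+gz≤δ (Y ⊕ Z) , widen gy+gz≤δ (Y ⊕ ⊖ Z)
  , widen gaps≤δ (X ⊕ Y ⊕ Z) , widen gaps≤δ (X ⊕ ⊖ Y ⊕ Z)
  , widen gaps≤δ (X ⊕ Y ⊕ ⊖ Z) , widen gaps≤δ (X ⊕ ⊖ Y ⊕ ⊖ Z)
  where
  gx = gap xm xM x
  gy = gap ym yM y
  gz = gap zm zM z
  X = gap-within xm xM x
  Y = gap-within ym yM y
  Z = gap-within zm zM z
  instance
    gx-nonNeg : NonNegative gx
    gx-nonNeg = nonNegative (0≤gap xm xM x)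
    gy-nonNeg : NonNegative gy
    gy-nonNeg = nonNegative (0≤gap ym yM y)
    gz-nonNeg : NonNegative gz
    gz-nonNeg = nonNegative (0≤gap zm zM z)
  gx+gy≤δ : gx + gy ≤ δ
  gx+gy≤δ = ≤-trans (i≤i+j (gx + gy) gz) gaps≤δ
  gx+gz≤δ : gx + gz ≤ δ
  gx+gz≤δ = ≤-trans (+-monoˡ-≤ gz (i≤i+j gx gy)) gaps≤δ
  gy+gz≤δ : gy + gz ≤ δ
  gy+gz≤δ = ≤-trans (+-monoˡ-≤ gz (i≤j+i gy gx)) gaps≤δ
  gx≤δ : gx ≤ δ
  gx≤δ = ≤-trans (i≤i+j gx gy) gx+gy≤δ
  gy≤δ : gy ≤ δ
  gy≤δ = ≤-trans (i≤j+i gy gx) gx+gy≤δ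
  gz≤δ : gz ≤ δ
  gz≤δ = ≤-trans (i≤j+i gz gy) gy+gz≤δ

-- Each choice of the three branches of the maxima is bounded by one region inequality.
region⇒gaps≤ : ∀ δ xm xM ym yM zm zM {x y z} → 0ℤ ≤ δ →
  Region δ xm xM ym yM zm zM (x , y , z) → gap xm xM x + gap ym yM y + gap zm zM z ≤ δ
region⇒gaps≤ δ xm xM ym yM zm zM {x} {y} {z} 0≤δ
  ( (x↓ , x↑) , (y↓ , y↑) , (z↓ , z↑) , (x+y↓ , x+y↑) , (x-y↓ , x-y↑)
  , (x+z↓ , x+z↑) , (x-z↓ , x-z↑) , (y+z↓ , y+z↑) , (y-z↓ , y-z↑)
  , (x+y+z↓ , x+y+z↑) , (x-y+z↓ , x-y+z↑) , (x+y-z↓ , x+y-z↑) , (x-y-z↓ , x-y-z↑))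
  = bound (gapView xm xM x) (gapView ym yM y) (gapView zm zM z)
  where
  vars = x ∷ y ∷ z ∷ xm ∷ xM ∷ ym ∷ yM ∷ zm ∷ zM ∷ δ ∷ []
  bound : GapView xm xM x → GapView ym yM y → GapView zm zM z →
          gap xm xM x + gap ym yM y + gap zm zM z ≤ δ
  bound (below  gx) (below  gy) (below  gz) rewrite gx | gy | gz = ≤-resp-difference x+y+z↓ (solve vars)
  bound (below  gx) (below  gy) (inside gz) rewrite gx | gy | gz = ≤-resp-difference x+y↓   (solve vars)
  bound (below  gx) (below  gy) (above  gz) rewrite gx | gy | gz = ≤-resp-difference x+y-z↓ (solve vars)
  bound (below  gx) (inside gy) (below  gz) rewrite gx | gy | gz = ≤-resp-difference x+z↓   (solve vars)
  bound (below  gx) (inside gy) (inside gz) rewrite gx | gy | gz = ≤-resp-difference x↓     (solve vars)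
  bound (below  gx) (inside gy) (above  gz) rewrite gx | gy | gz = ≤-resp-difference x-z↓   (solve vars)
  bound (below  gx) (above  gy) (below  gz) rewrite gx | gy | gz = ≤-resp-difference x-y+z↓ (solve vars)
  bound (below  gx) (above  gy) (inside gz) rewrite gx | gy | gz = ≤-resp-difference x-y↓   (solve vars)
  bound (below  gx) (above  gy) (above  gz) rewrite gx | gy | gz = ≤-resp-difference x-y-z↓ (solve vars)
  bound (inside gx) (below  gy) (below  gz) rewrite gx | gy | gz = ≤-resp-difference y+z↓   (solve vars)
  bound (inside gx) (below  gy) (inside gz) rewrite gx | gy | gz = ≤-resp-difference y↓     (solve vars)
  bound (inside gx) (below  gy) (above  gz) rewrite gx | gy | gz = ≤-resp-difference y-z↓   (solve vars)
  bound (inside gx) (inside gy) (below  gz) rewrite gx | gy | gz = ≤-resp-difference z↓     (solve vars)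
  bound (inside gx) (inside gy) (inside gz) rewrite gx | gy | gz = ≤-resp-difference 0≤δ    (solve vars)
  bound (inside gx) (inside gy) (above  gz) rewrite gx | gy | gz = ≤-resp-difference z↑     (solve vars)
  bound (inside gx) (above  gy) (below  gz) rewrite gx | gy | gz = ≤-resp-difference y-z↑   (solve vars)
  bound (inside gx) (above  gy) (inside gz) rewrite gx | gy | gz = ≤-resp-difference y↑     (solve vars)
  bound (inside gx) (above  gy) (above  gz) rewrite gx | gy | gz = ≤-resp-difference y+z↑   (solve vars)
  bound (above  gx) (below  gy) (below  gz) rewrite gx | gy | gz = ≤-resp-difference x-y-z↑ (solve vars)
  bound (above  gx) (below  gy) (inside gz) rewrite gx | gy | gz = ≤-resp-difference x-y↑   (solve vars)
  bound (above  gx) (below  gy) (above  gz) rewrite gx | gy | gz = ≤-resp-difference x-y+z↑ (solve vars)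
  bound (above  gx) (inside gy) (below  gz) rewrite gx | gy | gz = ≤-resp-difference x-z↑   (solve vars)
  bound (above  gx) (inside gy) (inside gz) rewrite gx | gy | gz = ≤-resp-difference x↑     (solve vars)
  bound (above  gx) (inside gy) (above  gz) rewrite gx | gy | gz = ≤-resp-difference x+z↑   (solve vars)
  bound (above  gx) (above  gy) (below  gz) rewrite gx | gy | gz = ≤-resp-difference x+y-z↑ (solve vars)
  bound (above  gx) (above  gy) (inside gz) rewrite gx | gy | gz = ≤-resp-difference x+y↑   (solve vars)
  bound (above  gx) (above  gy) (above  gz) rewrite gx | gy | gz = ≤-resp-difference x+y+z↑ (solve vars)

-- spread a b c = (a ⊔ b ⊔ c) - (a ⊓ b ⊓ c)
spread : ℤ → ℤ → ℤ → ℤ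
spread a b c = + ∣ a - b ∣ + gap (a ⊓ b) (a ⊔ b) c

window⇒spread≤ : ∀ {lo hi c k} → hi - lo ≤ k → hi - c ≤ k → c - lo ≤ k → (hi - lo) + gap lo hi c ≤ k
window⇒spread≤ {lo} {hi} {c} {k} hi-lo≤k hi-c≤k c-lo≤k =
  ≤-trans (+-monoʳ-≤ (hi - lo) gap≤) (≤-reflexive cancel)
  where
  vars = lo ∷ hi ∷ c ∷ k ∷ []
  cancel : (hi - lo) + (k - (hi - lo)) ≡ k
  cancel = solve vars
  gap≤ : gap lo hi c ≤ k - (hi - lo)
  gap≤ = gap-lub {lo} {hi} {c} (≤-resp-difference c-lo≤k (solve vars))
                               (≤-resp-difference hi-c≤k (solve vars))
                               (≤-resp-difference hi-lo≤k (solve vars))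

spread≤ : ∀ a b c {k} → ∣ a - b ∣ ℕ.≤ k → ∣ a - c ∣ ℕ.≤ k → ∣ b - c ∣ ℕ.≤ k → spread a b c ≤ + k
spread≤ a b c {k} ab≤k ac≤k bc≤k =
  subst (λ r → r + gap (a ⊓ b) (a ⊔ b) c ≤ + k) (⊔-minus-⊓ a b)
    (window⇒spread≤ {a ⊓ b} {a ⊔ b} hi-lo≤k hi-c≤k c-lo≤k)
  where
  difference≤ : ∀ i j → ∣ i - j ∣ ℕ.≤ k → i - j ≤ + k
  difference≤ i j ij≤k = ≤-trans (i≤∣i∣ (i - j)) (+≤+ ij≤k)
  difference≤′ : ∀ i j → ∣ i - j ∣ ℕ.≤ k → j - i ≤ + k
  difference≤′ i j ij≤k = difference≤ j i (subst (ℕ._≤ k) (∣i-j∣≡∣j-i∣ i j) ij≤k)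
  hi-lo≤k : (a ⊔ b) - (a ⊓ b) ≤ + k
  hi-lo≤k = subst (_≤ + k) (sym (⊔-minus-⊓ a b)) (+≤+ ab≤k)
  hi-c≤k : (a ⊔ b) - c ≤ + k
  hi-c≤k with ⊔-sel a b
  ... | inj₁ hi≡a rewrite hi≡a = difference≤ a c ac≤k
  ... | inj₂ hi≡b rewrite hi≡b = difference≤ b c bc≤k
  c-lo≤k : c - (a ⊓ b) ≤ + k
  c-lo≤k with ⊓-sel a b
  ... | inj₁ lo≡a rewrite lo≡a = difference≤′ a c ac≤k
  ... | inj₂ lo≡b rewrite lo≡b = difference≤′ b c bc≤k

projection : ∀ {lo hi} → lo ≤ hi → ∀ c → ∃ λ m → lo ≤ m × m ≤ hi × + ∣ m - c ∣ ≤ gap lo hi c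
projection {lo} {hi} lo≤hi c with ≤-total c lo | ≤-total c hi
... | inj₁ c≤lo | _ =
  lo , ≤-refl , lo≤hi , subst (_≤ gap lo hi c) (sym (∣-∣-≥ c≤lo)) (below≤gap lo hi c)
... | inj₂ lo≤c | inj₁ c≤hi =
  c , lo≤c , c≤hi , subst (_≤ gap lo hi c) (sym (cong +_ (∣i-i∣≡0 c))) (0≤gap lo hi c)
... | inj₂ lo≤c | inj₂ hi≤c =
  hi , lo≤hi , ≤-refl , subst (_≤ gap lo hi c) (sym (∣-∣-≤ hi≤c)) (above≤gap lo hi c)

∣m-a∣+∣m-b∣≡b-a : ∀ {a b m} → a ≤ m → m ≤ b → + (∣ m - a ∣ ℕ.+ ∣ m - b ∣) ≡ b - a
∣m-a∣+∣m-b∣≡b-a {a} {b} {m} a≤m m≤b = begin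
  + (∣ m - a ∣ ℕ.+ ∣ m - b ∣)  ≡⟨ pos-+ ∣ m - a ∣ ∣ m - b ∣ ⟩
  + ∣ m - a ∣ + + ∣ m - b ∣    ≡⟨ cong₂ _+_ (∣-∣-≥ a≤m) (∣-∣-≤ m≤b) ⟩
  (m - a) + (b - m)            ≡⟨ solve (a ∷ b ∷ m ∷ []) ⟩
  b - a                        ∎
  where open ≡-Reasoning

∣m-a∣+∣m-b∣≡∣a-b∣ : ∀ {a b m} → a ⊓ b ≤ m → m ≤ a ⊔ b → ∣ m - a ∣ ℕ.+ ∣ m - b ∣ ≡ ∣ a - b ∣
∣m-a∣+∣m-b∣≡∣a-b∣ {a} {b} {m} lo≤m m≤hi with ≤-total a b
... | inj₁ a≤b = +-injective (trans
  (∣m-a∣+∣m-b∣≡b-a (subst (_≤ m) (i≤j⇒i⊓j≡i a≤b) lo≤m) (subst (m ≤_) (i≤j⇒i⊔j≡j a≤b) m≤hi))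
  (sym (∣-∣-≤ a≤b)))
... | inj₂ b≤a = +-injective (trans (cong +_ (ℕₚ.+-comm ∣ m - a ∣ ∣ m - b ∣)) (trans
  (∣m-a∣+∣m-b∣≡b-a (subst (_≤ m) (i≥j⇒i⊓j≡j b≤a) lo≤m) (subst (m ≤_) (i≥j⇒i⊔j≡i b≤a) m≤hi))
  (sym (∣-∣-≥ b≤a))))

median : ∀ a b c → ∃ λ m → + (∣ m - a ∣ ℕ.+ ∣ m - b ∣ ℕ.+ ∣ m - c ∣) ≤ spread a b c
median a b c with projection (i⊓j≤i⊔j a b) c
... | m , lo≤m , m≤hi , mc≤gap = m , (begin
  + (∣ m - a ∣ ℕ.+ ∣ m - b ∣ ℕ.+ ∣ m - c ∣)  ≡⟨ pos-+ (∣ m - a ∣ ℕ.+ ∣ m - b ∣) ∣ m - c ∣ ⟩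
  + (∣ m - a ∣ ℕ.+ ∣ m - b ∣) + + ∣ m - c ∣  ≡⟨ cong (λ r → + r + + ∣ m - c ∣) (∣m-a∣+∣m-b∣≡∣a-b∣ lo≤m m≤hi) ⟩
  + ∣ a - b ∣ + + ∣ m - c ∣                  ≤⟨ +-monoʳ-≤ (+ ∣ a - b ∣) mc≤gap ⟩
  spread a b c                               ∎)
  where open ≤-Reasoning

-- Trees: lower bound

proj-x proj-y proj-z : Point → ℤ
proj-x (x , _ , _) = x
proj-y (_ , y , _) = y
proj-z (_ , _ , z) = z

axisLength : (Point → ℤ) → ∀ {n vs} → TreeOn n vs → ℕ
axisLength π (single _)         = 0
axisLength π (grow u w t _ _ _) = ∣ π u - π w ∣ ℕ.+ axisLength π t

axisLengths-sum : ∀ {n vs} (t : TreeOn n vs) →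
  axisLength proj-x t ℕ.+ axisLength proj-y t ℕ.+ axisLength proj-z t ≡ n
axisLengths-sum (single _)             = refl
axisLengths-sum (grow u w t _ _ u~w) =
  trans (ℕ-+-interchange₃ (∣ proj-x u - proj-x w ∣) (∣ proj-y u - proj-y w ∣) (∣ proj-z u - proj-z w ∣)
                           (axisLength proj-x t) (axisLength proj-y t) (axisLength proj-z t))
        (cong₂ ℕ._+_ u~w (axisLengths-sum t))

Diameter≤ : (Point → ℤ) → List Point → ℕ → Set
Diameter≤ π vs k = ∀ {p q} → p ∈ vs → q ∈ vs → ∣ π p - π q ∣ ℕ.≤ k

axisLength-diameter : ∀ π {n vs} (t : TreeOn n vs) → Diameter≤ π vs (axisLength π t)
axisLength-diameter π (single p) (here refl) (here refl) = ℕₚ.≤-reflexive (∣i-i∣≡0 (π p))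
axisLength-diameter π (grow {vs = vs} u w t u∈ _ _) = diameter
  where
  e = ∣ π u - π w ∣
  L = axisLength π t
  from-w : ∀ {q} → q ∈ vs → ∣ π w - π q ∣ ℕ.≤ e ℕ.+ L
  from-w {q} q∈ = ℕₚ.≤-trans (∣i-k∣≤∣i-j∣+∣j-k∣ (π w) (π u) (π q))
    (ℕₚ.+-mono-≤ (ℕₚ.≤-reflexive (∣i-j∣≡∣j-i∣ (π w) (π u))) (axisLength-diameter π t u∈ q∈))
  diameter : Diameter≤ π (w ∷ vs) (e ℕ.+ L)
  diameter (here refl) (here refl) = ℕₚ.≤-trans (ℕₚ.≤-reflexive (∣i-i∣≡0 (π w))) ℕ.z≤n
  diameter (here refl) (there q∈) = from-w q∈
  diameter {p} (there p∈) (here refl) = subst (ℕ._≤ e ℕ.+ L) (∣i-j∣≡∣j-i∣ (π w) (π p)) (from-w p∈)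
  diameter (there p∈) (there q∈) = ℕₚ.≤-trans (axisLength-diameter π t p∈ q∈) (ℕₚ.m≤n+m L e)

spreadSum : Point → Point → Point → ℤ
spreadSum (x₁ , y₁ , z₁) (x₂ , y₂ , z₂) (x , y , z) = spread x₁ x₂ x + spread y₁ y₂ y + spread z₁ z₂ z

spreadSum≤size : ∀ {n vs a b c} → TreeOn n vs → a ∈ vs → b ∈ vs → c ∈ vs → spreadSum a b c ≤ + n
spreadSum≤size {n} {a = a} {b} {c} t a∈ b∈ c∈ = begin
  spreadSum a b c                  ≤⟨ +-mono-≤ (+-mono-≤ (along proj-x) (along proj-y)) (along proj-z) ⟩
  + Lx + + Ly + + Lz               ≡⟨ sym (pos-+₃ Lx Ly Lz) ⟩
  + (Lx ℕ.+ Ly ℕ.+ Lz)             ≡⟨ cong +_ (axisLengths-sum t) ⟩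
  + n                              ∎
  where
  open ≤-Reasoning
  Lx = axisLength proj-x t
  Ly = axisLength proj-y t
  Lz = axisLength proj-z t
  along : ∀ π → spread (π a) (π b) (π c) ≤ + axisLength π t
  along π = spread≤ (π a) (π b) (π c) (D a∈ b∈) (D a∈ c∈) (D b∈ c∈)
    where D = axisLength-diameter π t

-- Trees: upper bound

record Extension (n : ℕ) (vs : List Point) (k : ℕ) (r : Point) : Set where
  field
    {size}     : ℕ
    {vertices} : List Point
    tree       : TreeOn size vertices
    size≤      : size ℕ.≤ n ℕ.+ k
    grows      : vs ⊆ vertices
    reaches    : r ∈ vertices

Reach : ℕ → Point → Point → Set
Reach k q r = ∀ {n vs} → TreeOn n vs → q ∈ vs → Extension n vs k r

reach-refl : ∀ {q} → Reach 0 q q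
reach-refl {n = n} t q∈ = record { tree = t ; size≤ = ℕₚ.m≤m+n n 0 ; grows = id ; reaches = q∈ }

reach-edge : ∀ {q r} → Adjacent q r → Reach 1 q r
reach-edge {q} {r} q~r {n} {vs} t q∈ with r ∈? vs
... | yes r∈ = record { tree = t ; size≤ = ℕₚ.m≤m+n n 1 ; grows = id ; reaches = r∈ }
... | no r∉  = record
  { tree = grow q r t q∈ r∉ q~r ; size≤ = ℕₚ.≤-reflexive (ℕₚ.+-comm 1 n) ; grows = there ; reaches = here refl }

reach-trans : ∀ {k j p q r} → Reach k p q → Reach j q r → Reach (k ℕ.+ j) p r
reach-trans {k} {j} p→q q→r {n} t p∈ = record
  { tree    = E₂.tree
  ; size≤   = ℕₚ.≤-trans E₂.size≤ (ℕₚ.≤-trans (ℕₚ.+-monoˡ-≤ j E₁.size≤) (ℕₚ.≤-reflexive (ℕₚ.+-assoc n k j)))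
  ; grows   = E₂.grows ∘ E₁.grows
  ; reaches = E₂.reaches
  }
  where
  module E₁ = Extension (p→q t p∈)
  module E₂ = Extension (q→r E₁.tree E₁.reaches)

∣i-[i+1]∣≡1 : ∀ i → ∣ i - (i + 1ℤ) ∣ ≡ 1
∣i-[i+1]∣≡1 i = cong ∣_∣ (difference i)
  where
  difference : ∀ i → i - (i + 1ℤ) ≡ -1ℤ
  difference = solve-∀

∣i-[i-1]∣≡1 : ∀ i → ∣ i - (i - 1ℤ) ∣ ≡ 1
∣i-[i-1]∣≡1 i = cong ∣_∣ (difference i)
  where
  difference : ∀ i → i - (i - 1ℤ) ≡ 1ℤ
  difference = solve-∀

module _ (g : ℤ → Point) (isometric : ∀ i j → dist (g i) (g j) ≡ ∣ i - j ∣) where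

  reach-up : ∀ a k → Reach k (g a) (g (a + + k))
  reach-up a zero    = subst (Reach 0 (g a) ∘ g) (sym (+-identityʳ a)) reach-refl
  reach-up a (suc k) = subst (Reach (suc k) (g a) ∘ g) shift
    (reach-trans (reach-edge (trans (isometric a (a + 1ℤ)) (∣i-[i+1]∣≡1 a))) (reach-up (a + 1ℤ) k))
    where
    shift : a + 1ℤ + + k ≡ a + + suc k
    shift = trans (+-assoc a 1ℤ (+ k)) (cong (_+_ a) (sym (pos-+ 1 k)))

  reach-down : ∀ a k → Reach k (g a) (g (a - + k))
  reach-down a zero    = subst (Reach 0 (g a) ∘ g) (sym (+-identityʳ a)) reach-refl
  reach-down a (suc k) = subst (Reach (suc k) (g a) ∘ g) shift
    (reach-trans (reach-edge (trans (isometric a (a - 1ℤ)) (∣i-[i-1]∣≡1 a))) (reach-down (a - 1ℤ) k))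
    where
    regroup : ∀ a b → a - 1ℤ - b ≡ a - (1ℤ + b)
    regroup = solve-∀
    shift : a - 1ℤ - + k ≡ a - + suc k
    shift = trans (regroup a (+ k)) (cong (_-_ a) (sym (pos-+ 1 k)))

  reach-line : ∀ a b → Reach ∣ a - b ∣ (g a) (g b)
  reach-line a b with ≤-total a b
  ... | inj₁ a≤b = subst (Reach ∣ a - b ∣ (g a) ∘ g) a+[b-a]≡b (reach-up a ∣ a - b ∣)
    where
    a+[b-a]≡b : a + + ∣ a - b ∣ ≡ b
    a+[b-a]≡b = trans (cong (_+_ a) (∣-∣-≤ a≤b)) (solve (a ∷ b ∷ []))
  ... | inj₂ b≤a = subst (Reach ∣ a - b ∣ (g a) ∘ g) a-[a-b]≡b (reach-down a ∣ a - b ∣)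
    where
    a-[a-b]≡b : a - + ∣ a - b ∣ ≡ b
    a-[a-b]≡b = trans (cong (_-_ a) (∣-∣-≥ b≤a)) (solve (a ∷ b ∷ []))

reach-dist : ∀ p q → Reach (dist p q) p q
reach-dist (px , py , pz) (qx , qy , qz) =
  reach-trans (reach-trans (reach-line (λ i → i , py , pz) along-x px qx)
                           (reach-line (λ i → qx , i , pz) along-y py qy))
              (reach-line (λ i → qx , qy , i) along-z pz qz)
  where
  along-x : ∀ i j → dist (i , py , pz) (j , py , pz) ≡ ∣ i - j ∣
  along-x i j rewrite ∣i-i∣≡0 py | ∣i-i∣≡0 pz = trans (ℕₚ.+-identityʳ _) (ℕₚ.+-identityʳ _)
  along-y : ∀ i j → dist (qx , i , pz) (qx , j , pz) ≡ ∣ i - j ∣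
  along-y i j rewrite ∣i-i∣≡0 qx | ∣i-i∣≡0 pz = ℕₚ.+-identityʳ _
  along-z : ∀ i j → dist (qx , qy , i) (qx , qy , j) ≡ ∣ i - j ∣
  along-z i j rewrite ∣i-i∣≡0 qx | ∣i-i∣≡0 qy = refl

Spanned : ℕ → List Point → Set
Spanned k ps = Σ ℕ λ n → Σ (List Point) λ vs → TreeOn n vs × n ℕ.≤ k × ps ⊆ vs

attach : ∀ {k ps q} → Spanned k ps → q ∈ ps → ∀ r → Spanned (k ℕ.+ dist q r) (r ∷ ps)
attach {q = q} (n , vs , t , n≤k , ps⊆vs) q∈ r =
  E.size , E.vertices , E.tree , ℕₚ.≤-trans E.size≤ (ℕₚ.+-monoˡ-≤ (dist q r) n≤k) , r∷ps⊆
  where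
  module E = Extension (reach-dist q r t (ps⊆vs q∈))
  r∷ps⊆ : r ∷ _ ⊆ E.vertices
  r∷ps⊆ (here refl) = E.reaches
  r∷ps⊆ (there p∈)  = E.grows (ps⊆vs p∈)

spanned-mono : ∀ {k k′ ps} → k ℕ.≤ k′ → Spanned k ps → Spanned k′ ps
spanned-mono k≤k′ (n , vs , t , n≤k , ps⊆vs) = n , vs , t , ℕₚ.≤-trans n≤k k≤k′ , ps⊆vs

spanned⇒tristance : ∀ {a b c d ps} → Spanned d (c ∷ b ∷ a ∷ ps) → Tristance≤ a b c d
spanned⇒tristance (n , vs , t , n≤d , ⊆vs) =
  n , vs , t , n≤d , ⊆vs (there (there (here refl))) , ⊆vs (there (here refl)) , ⊆vs (here refl)

ℕ-transpose₃ : ∀ a₁ a₂ a₃ b₁ b₂ b₃ c₁ c₂ c₃ →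
  (a₁ ℕ.+ a₂ ℕ.+ a₃) ℕ.+ (b₁ ℕ.+ b₂ ℕ.+ b₃) ℕ.+ (c₁ ℕ.+ c₂ ℕ.+ c₃)
  ≡ (a₁ ℕ.+ b₁ ℕ.+ c₁) ℕ.+ (a₂ ℕ.+ b₂ ℕ.+ c₂) ℕ.+ (a₃ ℕ.+ b₃ ℕ.+ c₃)
ℕ-transpose₃ = ℕ-Ring.solve-∀

-- The tree is the union of the paths from the coordinatewise median to a, b and c.
spreadSum≤⇒tristance : ∀ {a b c d} → spreadSum a b c ≤ + d → Tristance≤ a b c d
spreadSum≤⇒tristance {a@(x₁ , y₁ , z₁)} {b@(x₂ , y₂ , z₂)} {c@(x , y , z)} {d} spreadSum≤d =
  spanned⇒tristance (spanned-mono (drop‿+≤+ (≤-trans paths≤spreadSum spreadSum≤d)) spanned)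
  where
  mx = proj₁ (median x₁ x₂ x)
  my = proj₁ (median y₁ y₂ y)
  mz = proj₁ (median z₁ z₂ z)
  m : Point
  m = mx , my , mz
  base : Spanned 0 (m ∷ [])
  base = 0 , m ∷ [] , single m , ℕ.z≤n , id
  spanned : Spanned (0 ℕ.+ dist m a ℕ.+ dist m b ℕ.+ dist m c) (c ∷ b ∷ a ∷ m ∷ [])
  spanned = attach (attach (attach base (here refl) a) (there (here refl)) b) (there (there (here refl))) c
  axis : ∀ c₁ c₂ c₃ (mc : ℤ) → ℕ
  axis c₁ c₂ c₃ mc = ∣ mc - c₁ ∣ ℕ.+ ∣ mc - c₂ ∣ ℕ.+ ∣ mc - c₃ ∣
  paths≤spreadSum : + (dist m a ℕ.+ dist m b ℕ.+ dist m c) ≤ spreadSum a b c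
  paths≤spreadSum = begin
    + (dist m a ℕ.+ dist m b ℕ.+ dist m c)
      ≡⟨ cong +_ (ℕ-transpose₃ (∣ mx - x₁ ∣) (∣ my - y₁ ∣) (∣ mz - z₁ ∣)
                                (∣ mx - x₂ ∣) (∣ my - y₂ ∣) (∣ mz - z₂ ∣)
                                (∣ mx - x ∣)  (∣ my - y ∣)  (∣ mz - z ∣)) ⟩
    + (axis x₁ x₂ x mx ℕ.+ axis y₁ y₂ y my ℕ.+ axis z₁ z₂ z mz)
      ≡⟨ pos-+₃ (axis x₁ x₂ x mx) (axis y₁ y₂ y my) (axis z₁ z₂ z mz) ⟩
    + axis x₁ x₂ x mx + + axis y₁ y₂ y my + + axis z₁ z₂ z mz
      ≤⟨ +-mono-≤ (+-mono-≤ (proj₂ (median x₁ x₂ x)) (proj₂ (median y₁ y₂ y))) (proj₂ (median z₁ z₂ z)) ⟩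
    spreadSum a b c ∎
    where open ≤-Reasoning

tristance⇔spreadSum≤ : ∀ {a b c d} → Tristance≤ a b c d ⇔ spreadSum a b c ≤ + d
tristance⇔spreadSum≤ = mk⇔
  (λ (n , vs , t , n≤d , a∈ , b∈ , c∈) → ≤-trans (spreadSum≤size t a∈ b∈ c∈) (+≤+ n≤d))
  spreadSum≤⇒tristance

gapSum : Point → Point → Point → ℤ
gapSum (x₁ , y₁ , z₁) (x₂ , y₂ , z₂) (x , y , z) =
  gap (x₁ ⊓ x₂) (x₁ ⊔ x₂) x + gap (y₁ ⊓ y₂) (y₁ ⊔ y₂) y + gap (z₁ ⊓ z₂) (z₁ ⊔ z₂) z

spreadSum≡dist+gapSum : ∀ a b c → spreadSum a b c ≡ + dist a b + gapSum a b c
spreadSum≡dist+gapSum (x₁ , y₁ , z₁) (x₂ , y₂ , z₂) (x , y , z) =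
  trans (+-interchange₃ (+ ∣ x₁ - x₂ ∣) (+ ∣ y₁ - y₂ ∣) (+ ∣ z₁ - z₂ ∣)
                        (gap (x₁ ⊓ x₂) (x₁ ⊔ x₂) x) (gap (y₁ ⊓ y₂) (y₁ ⊔ y₂) y) (gap (z₁ ⊓ z₂) (z₁ ⊔ z₂) z))
        (cong (_+ gapSum (x₁ , y₁ , z₁) (x₂ , y₂ , z₂) (x , y , z))
              (sym (pos-+₃ (∣ x₁ - x₂ ∣) (∣ y₁ - y₂ ∣) (∣ z₁ - z₂ ∣))))

spreadSum≤⇔gapSum≤ : ∀ {a b c d} → dist a b ℕ.≤ d →
  spreadSum a b c ≤ + d ⇔ gapSum a b c ≤ + (d ∸ dist a b)
spreadSum≤⇔gapSum≤ {a} {b} {c} {d} D≤d = mk⇔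
  (λ spreadSum≤d → +-cancelˡ-≤ (+ D) (subst₂ _≤_ (spreadSum≡dist+gapSum a b c) d≡D+δ spreadSum≤d))
  (λ gapSum≤δ → subst₂ _≤_ (sym (spreadSum≡dist+gapSum a b c)) (sym d≡D+δ) (+-monoʳ-≤ (+ D) gapSum≤δ))
  where
  D = dist a b
  d≡D+δ : + d ≡ + D + + (d ∸ D)
  d≡D+δ = trans (cong +_ (sym (ℕₚ.m+[n∸m]≡n D≤d))) (pos-+ D (d ∸ D))

gapSum≤⇔inRegion : ∀ {d v₁ v₂ p} → gapSum v₁ v₂ p ≤ + (d ∸ dist v₁ v₂) ⇔ InRegion d v₁ v₂ p
gapSum≤⇔inRegion {d} {x₁ , y₁ , z₁} {x₂ , y₂ , z₂} {x , y , z} =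
  mk⇔ (gaps≤⇒region δ (x₁ ⊓ x₂) (x₁ ⊔ x₂) (y₁ ⊓ y₂) (y₁ ⊔ y₂) (z₁ ⊓ z₂) (z₁ ⊔ z₂))
      (region⇒gaps≤ δ (x₁ ⊓ x₂) (x₁ ⊔ x₂) (y₁ ⊓ y₂) (y₁ ⊔ y₂) (z₁ ⊓ z₂) (z₁ ⊔ z₂) (+≤+ ℕ.z≤n))
  where δ = + (d ∸ dist (x₁ , y₁ , z₁) (x₂ , y₂ , z₂))

tristance⇔inRegion : ∀ {d v₁ v₂ p} → dist v₁ v₂ ℕ.≤ d → Tristance≤ v₁ v₂ p d ⇔ InRegion d v₁ v₂ p
tristance⇔inRegion {d} {v₁} {v₂} {p} D≤d =
  ⇔-trans (tristance⇔spreadSum≤ {v₁} {v₂} {p} {d})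
          (⇔-trans (spreadSum≤⇔gapSum≤ {v₁} {v₂} {p} D≤d) (gapSum≤⇔inRegion {d} {v₁} {v₂} {p}))

interval : ℤ → ℤ → List ℤ
interval lo hi = applyUpTo (λ i → lo + + i) (suc ∣ hi - lo ∣)

interval-unique : ∀ lo hi → Unique (interval lo hi)
interval-unique lo hi = Unique.applyUpTo⁺₁ _ (suc ∣ hi - lo ∣)
  (λ i<j _ lo+i≡lo+j → ℕₚ.<⇒≢ i<j (+-injective (∙-cancelˡ lo _ _ lo+i≡lo+j)))

∈-interval : ∀ {lo hi c} → lo ≤ c → c ≤ hi → c ∈ interval lo hi
∈-interval {lo} {hi} {c} lo≤c c≤hi =
  subst (_∈ interval lo hi) lo+[c-lo]≡c (∈-applyUpTo⁺ (λ i → lo + + i) (ℕ.s≤s c-lo≤hi-lo))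
  where
  lo+[c-lo]≡c : lo + + ∣ c - lo ∣ ≡ c
  lo+[c-lo]≡c = trans (cong (_+_ lo) (∣-∣-≥ lo≤c)) (solve (lo ∷ c ∷ []))
  c-lo≤hi-lo : ∣ c - lo ∣ ℕ.≤ ∣ hi - lo ∣
  c-lo≤hi-lo = drop‿+≤+ (subst₂ _≤_ (sym (∣-∣-≥ lo≤c)) (sym (∣-∣-≥ (≤-trans lo≤c c≤hi)))
                                   (+-monoˡ-≤ (- lo) c≤hi))

box : ℤ → Point → Point → List Point
box δ (x₁ , y₁ , z₁) (x₂ , y₂ , z₂) =
  cartesianProduct (interval (x₁ ⊓ x₂ - δ) (x₁ ⊔ x₂ + δ))
    (cartesianProduct (interval (y₁ ⊓ y₂ - δ) (y₁ ⊔ y₂ + δ)) (interval (z₁ ⊓ z₂ - δ) (z₁ ⊔ z₂ + δ)))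

box-unique : ∀ δ v₁ v₂ → Unique (box δ v₁ v₂)
box-unique δ (x₁ , y₁ , z₁) (x₂ , y₂ , z₂) =
  Unique.cartesianProduct⁺ (interval-unique (x₁ ⊓ x₂ - δ) (x₁ ⊔ x₂ + δ))
    (Unique.cartesianProduct⁺ (interval-unique (y₁ ⊓ y₂ - δ) (y₁ ⊔ y₂ + δ))
                              (interval-unique (z₁ ⊓ z₂ - δ) (z₁ ⊔ z₂ + δ)))

inRegion⇒∈box : ∀ {d v₁ v₂ p} → InRegion d v₁ v₂ p → p ∈ box (+ (d ∸ dist v₁ v₂)) v₁ v₂
inRegion⇒∈box ((x↓ , x↑) , (y↓ , y↑) , (z↓ , z↑) , _) =
  ∈-cartesianProduct⁺ (∈-interval x↓ x↑) (∈-cartesianProduct⁺ (∈-interval y↓ y↑) (∈-interval z↓ z↑))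

tristanceBall : ℕ → Point → Point → List Point
tristanceBall d v₁ v₂ = filter (λ p → spreadSum v₁ v₂ p ≤? + d) (box (+ (d ∸ dist v₁ v₂)) v₁ v₂)

tristanceBall-unique : ∀ d v₁ v₂ → Unique (tristanceBall d v₁ v₂)
tristanceBall-unique d v₁ v₂ = Unique.filter⁺ (λ p → spreadSum v₁ v₂ p ≤? + d) (box-unique _ v₁ v₂)

∈-tristanceBall : ∀ {d v₁ v₂ p} → dist v₁ v₂ ℕ.≤ d → p ∈ tristanceBall d v₁ v₂ ⇔ Tristance≤ v₁ v₂ p d
∈-tristanceBall {d} {v₁} {v₂} {p} D≤d = mk⇔
  (λ p∈ball → from tristance⇔spreadSum≤ (proj₂ (∈-filter⁻ P? {xs = box _ v₁ v₂} p∈ball)))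
  (λ p-tri → ∈-filter⁺ P? (inRegion⇒∈box {d} {v₁} {v₂} (to (tristance⇔inRegion D≤d) p-tri))
                          (to tristance⇔spreadSum≤ p-tri))
  where P? = λ q → spreadSum v₁ v₂ q ≤? + d

∈-─ : ∀ {A : List Point} {b p} (b∈A : b ∈ A) → p ∈ A → b ≢ p → p ∈ A ─ b∈A
∈-─ (here refl) (here refl) b≢p = ⊥-elim (b≢p refl)
∈-─ (here refl) (there p∈)  _   = p∈
∈-─ (there b∈)  (here refl) _   = here refl
∈-─ (there b∈)  (there p∈)  b≢p = there (∈-─ b∈ p∈ b≢p)

Unique⇒length≤ : ∀ {A B : List Point} → Unique B → B ⊆ A → length B ℕ.≤ length A
Unique⇒length≤ {A} {[]}    _              _      = ℕ.z≤n
Unique⇒length≤ {A} {b ∷ B} (b∉B ∷ B-unique) b∷B⊆A =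
  subst (suc (length B) ℕ.≤_) (sym (length-removeAt′ A (index b∈A)))
    (ℕ.s≤s (Unique⇒length≤ B-unique (λ p∈B → ∈-─ b∈A (b∷B⊆A (there p∈B)) (All.lookup b∉B p∈B))))
  where b∈A = b∷B⊆A (here refl)

listing⇒optimal : ∀ {d v₁ v₂ L} → Unique L → (∀ {p} → p ∈ L ⇔ Tristance≤ v₁ v₂ p d) →
  IsOptimalAnticode d v₁ v₂ L
listing⇒optimal L-unique ∈L⇔ =
  (L-unique , All.tabulate (to ∈L⇔)) ,
  λ B (B-unique , B-tri) → Unique⇒length≤ B-unique (λ p∈B → from ∈L⇔ (All.lookup B-tri p∈B))

optimal⇒complete : ∀ {d v₁ v₂ A p} → IsOptimalAnticode d v₁ v₂ A → Tristance≤ v₁ v₂ p d → p ∈ A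
optimal⇒complete {A = A} {p} ((A-unique , A-tri) , maximum) p-tri with p ∈? A
... | yes p∈A = p∈A
... | no  p∉A = ⊥-elim (ℕₚ.n≮n (length A) (maximum (p ∷ A) (p∷A-unique , p-tri All.∷ A-tri)))
  where
  p∷A-unique : Unique (p ∷ A)
  p∷A-unique = All.tabulate (λ q∈A p≡q → p∉A (subst (_∈ A) (sym p≡q) q∈A)) ∷ A-unique


theorem29 : (v₁ v₂ : Point) → v₁ ≢ v₂ → (d : ℕ) → dist v₁ v₂ ℕ.≤ d →
    Σ (List Point) (IsOptimalAnticode d v₁ v₂)
    × ((A : List Point) → IsOptimalAnticode d v₁ v₂ A →
    (p : Point) → (p ∈ A) ⇔ InRegion d v₁ v₂ p)
theorem29 v₁ v₂ _ d D≤d =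
  (tristanceBall d v₁ v₂ , listing⇒optimal (tristanceBall-unique d v₁ v₂) (∈-tristanceBall D≤d)) ,
  λ A A-optimal p → mk⇔
    (λ p∈A → to (tristance⇔inRegion D≤d) (All.lookup (proj₂ (proj₁ A-optimal)) p∈A))
    (λ p-region → optimal⇒complete A-optimal (from (tristance⇔inRegion D≤d) p-region))
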